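{- Let $q$ be a prime power, $m$ a positive integer and $s\in\{1,\ldots,m\}$ with $\gcd(s,m)=1$. Then \[ \mathrm{stab}_{\mathrm{GL}(m,q^m)}(G_{m,s,m})=\{D_f : f\in\tilde{\mathcal{L}}_{m,q^s},\ f \text{ invertible}\}. \]
   Context: $G_{m,s,m}=\{(x,x^{q^s},\ldots,x^{q^{s(m-1)}}):x\in\mathbb{F}_{q^m}\}\subseteq\mathbb{F}_{q^m}^m$ (an $\mathbb{F}_q$-subspace). Matrices act on column vectors, and $\mathrm{stab}_{\mathrm{GL}(m,q^m)}(G_{m,s,m})$ is the set of $A\in\mathrm{GL}(m,q^m)$ with $\{Au:u\in G_{m,s,m}\}=G_{m,s,m}$. $\tilde{\mathcal{L}}_{m,q^s}$ denotes the set of $q^s$-polynomials $f(x)=a_0x+a_1x^{q^s}+\cdots+a_{m-1}x^{q^{s(m-1)}}$ with $a_i\in\mathbb{F}_{q^m}$, viewed as $\mathbb{F}_q$-linear maps $\mathbb{F}_{q^m}\to\mathbb{F}_{q^m}$; $f$ is invertible if this map is bijective. The Dickson matrix of such $f$ is the $m\times m$ matrix $D_f$ whose $(i,j)$ entry ($i,j\in\{0,\ldots,m-1\}$) is $a_{(j-i)\bmod m}^{q^{si}}$, i.e. \[ D_f=\begin{pmatrix} a_0&a_1&\cdots&a_{m-1}\\ a_{m-1}^{q^s}&a_0^{q^s}&\cdots&a_{m-2}^{q^s}\\ \vdots&&&\vdots\\ a_1^{q^{s(m-1)}}&a_2^{q^{s(m-1)}}&\cdots&a_0^{q^{s(m-1)}}\end{pmatrix}.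 \] -}

module Defs where

open import Level using (0ℓ)
open import Algebra.Bundles using (CommutativeRing)
open import Data.Nat as ℕ using (ℕ; zero; suc; NonZero; _≤_)
open import Data.Nat.DivMod using (_%_; m%n<n)
open import Data.Nat.Primality using (Prime)
open import Data.Fin using (Fin; toℕ; fromℕ<; _≟_)
open import Relation.Nullary using (yes; no)
open import Data.Product using (Σ; ∃; _×_; _,_)
open import Relation.Nullary using (¬_)
open import Relation.Binary.PropositionalEquality using (_≡_)

IsPrimePower : ℕ → Set
IsPrimePower q = Σ ℕ λ p → Σ ℕ λ k → Prime p × 1 ≤ k × q ≡ p ℕ.^ k

module _ (R : CommutativeRing 0ℓ 0ℓ) where
  open CommutativeRing R

  record IsFieldOfOrder (N : ℕ) : Set where
    field
      0≉1      : ¬ (0# ≈ 1#)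
      inverse  : ∀ x → ¬ (x ≈ 0#) → Σ Carrier λ y → x * y ≈ 1#
      enum     : Fin N → Carrier
      enum-inj : ∀ i j → enum i ≈ enum j → i ≡ j
      enum-sur : ∀ x → Σ (Fin N) λ i → enum i ≈ x

  pow : Carrier → ℕ → Carrier
  pow x zero    = 1#
  pow x (suc n) = x * pow x n

  sumFin : (m : ℕ) → (Fin m → Carrier) → Carrier
  sumFin zero    f = 0#
  sumFin (suc m) f = f Fin.zero + sumFin m (λ i → f (Fin.suc i))

  Vector : ℕ → Set
  Vector m = Fin m → Carrier

  Matrix : ℕ → Set
  Matrix m = Fin m → Fin m → Carrier

  apply : (m : ℕ) → Matrix m → Vector m → Vector m
  apply m A u i = sumFin m (λ j → A i j * u j)

  mmul : (m : ℕ) → Matrix m → Matrix m → Matrix m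
  mmul m A B i k = sumFin m (λ j → A i j * B j k)

  identity : (m : ℕ) → Matrix m
  identity m i j with i ≟ j
  ... | yes _ = 1#
  ... | no  _ = 0#

  _≈M_ : {m : ℕ} → Matrix m → Matrix m → Set
  A ≈M B = ∀ i j → A i j ≈ B i j

  _≈V_ : {m : ℕ} → Vector m → Vector m → Set
  u ≈V v = ∀ i → u i ≈ v i

  InGL : (m : ℕ) → Matrix m → Set
  InGL m A = Σ (Matrix m) λ B → mmul m A B ≈M identity m × mmul m B A ≈M identity m

  InG : (q m s : ℕ) → Vector m → Set
  InG q m s u = Σ Carrier λ x → ∀ j → u j ≈ pow x (q ℕ.^ (s ℕ.* toℕ j))

  InStab : (q m s : ℕ) → Matrix m → Set
  InStab q m s A =
    InGL m A
    × (∀ u → InG q m s u → InG q m s (apply m A u))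
    × (∀ v → InG q m s v → Σ (Vector m) λ u → InG q m s u × apply m A u ≈V v)

  evalQPoly : (q m s : ℕ) → Vector m → Carrier → Carrier
  evalQPoly q m s a x = sumFin m (λ j → a j * pow x (q ℕ.^ (s ℕ.* toℕ j)))

  InvertibleQPoly : (q m s : ℕ) → Vector m → Set
  InvertibleQPoly q m s a =
    (∀ x y → evalQPoly q m s a x ≈ evalQPoly q m s a y → x ≈ y)
    × (∀ y → Σ Carrier λ x → evalQPoly q m s a x ≈ y)

  -- Dickson matrix: (D_f)_{i j} = a_{(j - i) mod m}^{q^{s i}}
  dickson : (q m s : ℕ) .{{_ : NonZero m}} → Vector m → Matrix m
  dickson q m s a i j =
    pow (a (fromℕ< (m%n<n ((toℕ j ℕ.+ m) ℕ.∸ toℕ i) m))) (q ℕ.^ (s ℕ.* toℕ i))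

-- A matrix stabilising G is determined by the map it induces on G, because the coordinates
-- x ↦ x^(q^(s j)) of G are linearly independent functions on the field: as x^(q^m) = x and
-- gcd (s, m) = 1 they are distinct monomials of degree < q^m, and a polynomial of degree < q^m
-- vanishing on the whole field is zero. Since x ↦ x^(q^(s i)) is a ring endomorphism (q is a
-- power of the characteristic), the Dickson matrix D_f induces f on G; a stabilising A induces
-- the q^s-polynomial f read off its first row, so A = D_f, and f is bijective because A is.
-- Conversely D_f with f bijective preserves G, and it is invertible: q^s-polynomials are closed
-- under composition and finite in number, so some power fʳ is the identity and f^(r-1) = f⁻¹.

module Submission where

open import Defs
open import Level using (0ℓ)
open import Algebra.Bundles using (CommutativeRing)
open import Data.Nat using (ℕ; NonZero; _≤_; _^_)
open import Data.Nat.GCD using (gcd)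
open import Data.Product using (Σ; _×_)
open import Relation.Binary.PropositionalEquality using (_≡_)

open import Algebra.Bundles using (Monoid)
open import Data.Nat as ℕ using (zero; suc; _<_; z≤n; s≤s)
import Data.Nat.Properties as ℕ
open import Data.Nat.Combinatorics using (_C_; nCk≡n!/k![n-k]!; k![n∸k]!∣n!)
open import Data.Nat.Coprimality as Coprime using (coprime-divisor; gcd≡1⇒coprime)
open import Data.Nat.DivMod
open import Data.Nat.Divisibility using (_∣_; divides; ∣⇒≤; ∣1⇒≡1; m∣m*n; >⇒∤)
open import Data.Nat.Primality using (Prime; euclidsLemma; prime⇒nonTrivial; prime⇒nonZero)
open import Data.Fin as Fin using (Fin; toℕ; fromℕ<)
import Data.Fin.Properties as Fin
open import Data.Fin.Permutation as Perm using (Permutation; permutation; _⟨$⟩ʳ_)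
open import Data.Product using (_,_; proj₁; proj₂)
open import Data.Sum using (inj₁; inj₂)
open import Data.Empty using (⊥-elim)
open import Function using (_∘_)
open import Relation.Nullary using (¬_; Dec; yes; no)
open import Relation.Binary.Definitions using (tri<; tri≈; tri>)
open import Relation.Binary.PropositionalEquality as ≡ using (_≢_)

module Arithmetic where
  open import Data.Nat using (_+_; _*_; _∸_; _!)
  open ≡.≡-Reasoning

  prime∤n! : ∀ {p} → Prime p → ∀ n → n < p → ¬ p ∣ n !
  prime∤n! pr zero _ p∣1 = ℕ.<⇒≢ (ℕ.nonTrivial⇒n>1 _ {{prime⇒nonTrivial pr}}) (≡.sym (∣1⇒≡1 p∣1))
  prime∤n! pr (suc n) n<p p∣n! with euclidsLemma (suc n) (n !) pr p∣n!
  ... | inj₁ p∣1+n = ℕ.<⇒≱ n<p (∣⇒≤ p∣1+n)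
  ... | inj₂ p∣n! = prime∤n! pr n (ℕ.<-trans (ℕ.n<1+n n) n<p) p∣n!

  prime∣pCk : ∀ {p k} → Prime p → 0 < k → k < p → p ∣ p C k
  prime∣pCk {p} {k} pr 0<k k<p with euclidsLemma (p C k) (k ! * (p ∸ k) !) pr p∣pCk*k!*[p∸k]!
    where
    k![p∸k]! = k ! * (p ∸ k) !
    instance _ = ℕ._!*_!≢0 k (p ∸ k)
    p∣p! : ∀ {n} → 0 < n → n ∣ n !
    p∣p! {suc n} _ = m∣m*n (n !)
    p∣pCk*k!*[p∸k]! : p ∣ (p C k) * k![p∸k]!
    p∣pCk*k!*[p∸k]! = ≡.subst (p ∣_) (begin
      p !                        ≡⟨ m/n*n≡m (k![n∸k]!∣n! (ℕ.<⇒≤ k<p)) ⟨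
      p ! / k![p∸k]! * k![p∸k]!  ≡⟨ ≡.cong (_* k![p∸k]!) (nCk≡n!/k![n-k]! (ℕ.<⇒≤ k<p)) ⟨
      (p C k) * k![p∸k]!         ∎) (p∣p! (ℕ.<-trans 0<k k<p))
  ... | inj₁ p∣pCk = p∣pCk
  ... | inj₂ p∣k!*[p∸k]! with euclidsLemma (k !) ((p ∸ k) !) pr p∣k!*[p∸k]!
  ...   | inj₁ p∣k! = ⊥-elim (prime∤n! pr k k<p p∣k!)
  ...   | inj₂ p∣[p∸k]! = ⊥-elim (prime∤n! pr (p ∸ k) (ℕ.∸-monoʳ-< 0<k (ℕ.<⇒≤ k<p)) p∣[p∸k]!)

  ^-injectiveʳ : ∀ {b} → 1 < b → ∀ {m n} → b ^ m ≡ b ^ n → m ≡ n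
  ^-injectiveʳ {b} 1<b {m} {n} bᵐ≡bⁿ with ℕ.<-cmp m n
  ... | tri< m<n _ _ = ⊥-elim (ℕ.<-irrefl bᵐ≡bⁿ (ℕ.^-monoʳ-< b 1<b m<n))
  ... | tri≈ _ m≡n _ = m≡n
  ... | tri> _ _ n<m = ⊥-elim (ℕ.<-irrefl (≡.sym bᵐ≡bⁿ) (ℕ.^-monoʳ-< b 1<b n<m))

  %≡%⇒∣∸ : ∀ {d} .{{_ : NonZero d}} m n → m % d ≡ n % d → d ∣ m ∸ n
  %≡%⇒∣∸ {d} m n eq = divides (m / d ∸ n / d) (begin
    m ∸ n                                     ≡⟨ ≡.cong₂ _∸_ (m≡m%n+[m/n]*n m d) (m≡m%n+[m/n]*n n d) ⟩
    (m % d + m / d * d) ∸ (n % d + n / d * d) ≡⟨ ≡.cong (λ r → (r + m / d * d) ∸ (n % d + n / d * d)) eq ⟩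
    (n % d + m / d * d) ∸ (n % d + n / d * d) ≡⟨ ℕ.[m+n]∸[m+o]≡n∸o (n % d) _ _ ⟩
    m / d * d ∸ n / d * d                     ≡⟨ ℕ.*-distribʳ-∸ d (m / d) (n / d) ⟨
    (m / d ∸ n / d) * d                       ∎)

  ∣∧<⇒≡0 : ∀ {m n} → m ∣ n → n < m → n ≡ 0
  ∣∧<⇒≡0 {n = zero}  _   _   = ≡.refl
  ∣∧<⇒≡0 {n = suc n} m∣n n<m = ⊥-elim (>⇒∤ n<m m∣n)

  coprime⇒*-%-cancel : ∀ m s .{{_ : NonZero m}} → gcd s m ≡ 1 →
                       ∀ {a b} → a ≤ b → b < m → (s * a) % m ≡ (s * b) % m → a ≡ b
  coprime⇒*-%-cancel m s gcd≡1 {a} {b} a≤b b<m eq =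
    ℕ.≤-antisym a≤b (ℕ.m∸n≡0⇒m≤n (∣∧<⇒≡0 m∣b∸a (ℕ.≤-<-trans (ℕ.m∸n≤m b a) b<m)))
    where
    m∣b∸a : m ∣ b ∸ a
    m∣b∸a = coprime-divisor (Coprime.sym (gcd≡1⇒coprime {s} {m} gcd≡1))
              (≡.subst (m ∣_) (≡.sym (ℕ.*-distribˡ-∸ s b a)) (%≡%⇒∣∸ (s * b) (s * a) (≡.sym eq)))

  coprime⇒*-%-injective : ∀ m s .{{_ : NonZero m}} → gcd s m ≡ 1 →
                          ∀ {a b} → a < m → b < m → (s * a) % m ≡ (s * b) % m → a ≡ b
  coprime⇒*-%-injective m s gcd≡1 {a} {b} a<m b<m eq with ℕ.≤-total a b
  ... | inj₁ a≤b = coprime⇒*-%-cancel m s gcd≡1 a≤b b<m eq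
  ... | inj₂ b≤a = ≡.sym (coprime⇒*-%-cancel m s gcd≡1 b≤a a<m (≡.sym eq))

module Rotation {m : ℕ} .{{_ : NonZero m}} where
  open import Data.Nat using (_+_; _*_; _∸_)
  open ≡.≡-Reasoning

  [a%m+b]%m≡[a+b]%m : ∀ a b → (a % m + b) % m ≡ (a + b) % m
  [a%m+b]%m≡[a+b]%m a b = begin
    (a % m + b) % m           ≡⟨ %-distribˡ-+ (a % m) b m ⟩
    (a % m % m + b % m) % m   ≡⟨ ≡.cong (λ t → (t + b % m) % m) (m%n%n≡m%n a m) ⟩
    (a % m + b % m) % m       ≡⟨ %-distribˡ-+ a b m ⟨
    (a + b) % m               ∎

  [s*[a%m]]%m≡[s*a]%m : ∀ s a → (s * (a % m)) % m ≡ (s * a) % m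
  [s*[a%m]]%m≡[s*a]%m s a = begin
    (s * (a % m)) % m           ≡⟨ %-distribˡ-* s (a % m) m ⟩
    (s % m * (a % m % m)) % m   ≡⟨ ≡.cong (λ t → (s % m * t) % m) (m%n%n≡m%n a m) ⟩
    (s % m * (a % m)) % m       ≡⟨ %-distribˡ-* s a m ⟨
    (s * a) % m                 ∎

  [[k+i]%m+m∸i]%m≡k : ∀ {k i} → k < m → i ≤ m → ((k + i) % m + m ∸ i) % m ≡ k
  [[k+i]%m+m∸i]%m≡k {k} {i} k<m i≤m = begin
    ((k + i) % m + m ∸ i) % m    ≡⟨ ≡.cong (_% m) (ℕ.+-∸-assoc _ i≤m) ⟩
    ((k + i) % m + (m ∸ i)) % m  ≡⟨ [a%m+b]%m≡[a+b]%m (k + i) (m ∸ i) ⟩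
    (k + i + (m ∸ i)) % m        ≡⟨ ≡.cong (_% m) (ℕ.+-assoc k i (m ∸ i)) ⟩
    (k + (i + (m ∸ i))) % m      ≡⟨ ≡.cong (λ t → (k + t) % m) (ℕ.m+[n∸m]≡n i≤m) ⟩
    (k + m) % m                  ≡⟨ [m+n]%n≡m%n k m ⟩
    k % m                        ≡⟨ m<n⇒m%n≡m k<m ⟩
    k                            ∎

  [[j+m∸i]%m+i]%m≡j : ∀ {j i} → j < m → i ≤ m → ((j + m ∸ i) % m + i) % m ≡ j
  [[j+m∸i]%m+i]%m≡j {j} {i} j<m i≤m = begin
    ((j + m ∸ i) % m + i) % m  ≡⟨ [a%m+b]%m≡[a+b]%m (j + m ∸ i) i ⟩
    (j + m ∸ i + i) % m        ≡⟨ ≡.cong (_% m) (ℕ.m∸n+n≡m (ℕ.≤-trans i≤m (ℕ.m≤n+m m j))) ⟩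
    (j + m) % m                ≡⟨ [m+n]%n≡m%n j m ⟩
    j % m                      ≡⟨ m<n⇒m%n≡m j<m ⟩
    j                          ∎

  -- k ↦ k + i (mod m); its inverse j ↦ j + m ∸ i (mod m) is the column index used by dickson.
  rotate : Fin m → Permutation m m
  rotate i = permutation forth back
    (λ j → Fin.toℕ-injective (≡.trans (Fin.toℕ-fromℕ< _)
      (≡.trans (≡.cong (λ t → (t + toℕ i) % m) (Fin.toℕ-fromℕ< _)) ([[j+m∸i]%m+i]%m≡j (Fin.toℕ<n j) i≤m))))
    (λ k → Fin.toℕ-injective (≡.trans (Fin.toℕ-fromℕ< _)
      (≡.trans (≡.cong (λ t → (t + m ∸ toℕ i) % m) (Fin.toℕ-fromℕ< _)) ([[k+i]%m+m∸i]%m≡k (Fin.toℕ<n k) i≤m))))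
    where
    i≤m : toℕ i ≤ m
    i≤m = ℕ.<⇒≤ (Fin.toℕ<n i)
    forth back : Fin m → Fin m
    forth k = fromℕ< (m%n<n (toℕ k + toℕ i) m)
    back j = fromℕ< (m%n<n (toℕ j + m ∸ toℕ i) m)

  *-rotate-% : ∀ s (i k : Fin m) → (s * toℕ (rotate i ⟨$⟩ʳ k)) % m ≡ (s * toℕ k + s * toℕ i) % m
  *-rotate-% s i k = begin
    (s * toℕ (rotate i ⟨$⟩ʳ k)) % m   ≡⟨ ≡.cong (λ t → (s * t) % m) (Fin.toℕ-fromℕ< _) ⟩
    (s * ((toℕ k + toℕ i) % m)) % m  ≡⟨ [s*[a%m]]%m≡[s*a]%m s (toℕ k + toℕ i) ⟩
    (s * (toℕ k + toℕ i)) % m        ≡⟨ ≡.cong (_% m) (ℕ.*-distribˡ-+ s (toℕ k) (toℕ i)) ⟩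
    (s * toℕ k + s * toℕ i) % m      ∎

open Arithmetic
open Rotation

module _ {a ℓ} (M : Monoid a ℓ) where
  open Monoid M
  open import Algebra.Properties.Monoid.Sum M using (sum; sum-cong-≋; sum-replicate-zero)

  sum-single : ∀ {n} (f : Fin n → Carrier) k → (∀ i → i ≢ k → f i ≈ ε) → sum f ≈ f k
  sum-single {suc n} f Fin.zero f≈ε = trans (∙-congˡ sum-tail≈ε) (identityʳ _)
    where
    sum-tail≈ε : sum (f ∘ Fin.suc) ≈ ε
    sum-tail≈ε = trans (sum-cong-≋ (λ i → f≈ε (Fin.suc i) λ ())) (sum-replicate-zero n)
  sum-single {suc n} f (Fin.suc k) f≈ε =
    trans (∙-cong (f≈ε Fin.zero λ ())
                  (sum-single (f ∘ Fin.suc) k λ i i≢k → f≈ε (Fin.suc i) (i≢k ∘ Fin.suc-injective)))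
          (identityˡ _)

module Sums (R : CommutativeRing 0ℓ 0ℓ) where
  open CommutativeRing R
  open import Algebra.Properties.Semiring.Sum semiring
  open import Algebra.Properties.Ring ring using (x+x≈x⇒x≈0)
  open import Relation.Binary.Reasoning.Setoid setoid

  sumFin≡sum : ∀ n (f : Fin n → Carrier) → sumFin R n f ≡ sum f
  sumFin≡sum zero    f = ≡.refl
  sumFin≡sum (suc n) f = ≡.cong (f Fin.zero +_) (sumFin≡sum n (f ∘ Fin.suc))

  sumFin-cong : ∀ n {f g : Fin n → Carrier} → (∀ i → f i ≈ g i) → sumFin R n f ≈ sumFin R n g
  sumFin-cong n {f} {g} f≈g rewrite sumFin≡sum n f | sumFin≡sum n g = sum-cong-≋ f≈g

  sumFin-distrib-+ : ∀ n (f g : Fin n → Carrier) → sumFin R n (λ i → f i + g i) ≈ sumFin R n f + sumFin R n g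
  sumFin-distrib-+ n f g
    rewrite sumFin≡sum n (λ i → f i + g i) | sumFin≡sum n f | sumFin≡sum n g = ∑-distrib-+ f g

  *-distribˡ-sumFin : ∀ n x (f : Fin n → Carrier) → x * sumFin R n f ≈ sumFin R n (λ i → x * f i)
  *-distribˡ-sumFin n x f rewrite sumFin≡sum n f | sumFin≡sum n (λ i → x * f i) = *-distribˡ-sum x f

  *-distribʳ-sumFin : ∀ n x (f : Fin n → Carrier) → sumFin R n f * x ≈ sumFin R n (λ i → f i * x)
  *-distribʳ-sumFin n x f rewrite sumFin≡sum n f | sumFin≡sum n (λ i → f i * x) = *-distribʳ-sum x f

  sumFin-permute : ∀ n (f : Fin n → Carrier) (π : Permutation n n) →
                   sumFin R n f ≈ sumFin R n (λ i → f (π ⟨$⟩ʳ i))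
  sumFin-permute n f π rewrite sumFin≡sum n f | sumFin≡sum n (λ i → f (π ⟨$⟩ʳ i)) = ∑-permute f π

  sumFin-single : ∀ n (f : Fin n → Carrier) k → (∀ i → i ≢ k → f i ≈ 0#) → sumFin R n f ≈ f k
  sumFin-single n f k f≈0 rewrite sumFin≡sum n f = sum-single +-monoid f k f≈0

  sumFin-comm : ∀ m n (f : Fin m → Fin n → Carrier) →
                sumFin R m (λ i → sumFin R n (f i)) ≈ sumFin R n (λ j → sumFin R m (λ i → f i j))
  sumFin-comm m n f = begin
    sumFin R m (λ i → sumFin R n (f i))        ≡⟨ sumFin≡sum m _ ⟩
    sum (λ i → sumFin R n (f i))               ≡⟨ sum-cong-≗ (λ i → sumFin≡sum n (f i)) ⟩
    sum (λ i → sum (f i))                      ≈⟨ ∑-comm f ⟩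
    sum (λ j → sum (λ i → f i j))              ≡⟨ sum-cong-≗ (λ j → sumFin≡sum m (λ i → f i j)) ⟨
    sum (λ j → sumFin R m (λ i → f i j))       ≡⟨ sumFin≡sum n _ ⟨
    sumFin R n (λ j → sumFin R m (λ i → f i j)) ∎

  sumFin-homo : (h : Carrier → Carrier) → (∀ {x y} → x ≈ y → h x ≈ h y) → (∀ x y → h (x + y) ≈ h x + h y) →
                ∀ n (f : Fin n → Carrier) → h (sumFin R n f) ≈ sumFin R n (h ∘ f)
  sumFin-homo h h-cong h-+ zero    f = x+x≈x⇒x≈0 (h 0#) (trans (sym (h-+ 0# 0#)) (h-cong (+-identityʳ 0#)))
  sumFin-homo h h-cong h-+ (suc n) f =
    trans (h-+ _ _) (+-congˡ (sumFin-homo h h-cong h-+ n (f ∘ Fin.suc)))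

module Powers (R : CommutativeRing 0ℓ 0ℓ) where
  open CommutativeRing R
  import Algebra.Properties.CommutativeSemiring.Exp commutativeSemiring as Exp
  open import Algebra.Properties.CommutativeSemiring.Binomial commutativeSemiring using (theorem; binomialTerm)
  import Algebra.Properties.Semiring.Mult semiring as Mult
  open import Algebra.Properties.Semiring.Sum semiring using (sum)
  open import Data.Nat.Combinatorics using (nCn≡1)
  open import Relation.Binary.Reasoning.Setoid setoid

  pow≡^ : ∀ x n → pow R x n ≡ x Exp.^ n
  pow≡^ x zero    = ≡.refl
  pow≡^ x (suc n) = ≡.cong (x *_) (pow≡^ x n)

  pow-cong : ∀ n {x y} → x ≈ y → pow R x n ≈ pow R y n
  pow-cong n {x} {y} x≈y rewrite pow≡^ x n | pow≡^ y n = Exp.^-congˡ n x≈y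

  pow-pow : ∀ x a b → pow R (pow R x a) b ≈ pow R x (a ℕ.* b)
  pow-pow x a b rewrite pow≡^ (pow R x a) b | pow≡^ x a | pow≡^ x (a ℕ.* b) = Exp.^-assocʳ x a b

  pow-distrib-* : ∀ x y n → pow R (x * y) n ≈ pow R x n * pow R y n
  pow-distrib-* x y n rewrite pow≡^ (x * y) n | pow≡^ x n | pow≡^ y n = Exp.^-distrib-* x y n

  binomial-middle≈0⇒pow-homo-+ : ∀ n .{{_ : NonZero n}} →
                                 (∀ k → 0 < k → k < n → ∀ z → (n C k) Mult.× z ≈ 0#) →
                                 ∀ x y → pow R (x + y) n ≈ pow R x n + pow R y n
  binomial-middle≈0⇒pow-homo-+ (suc n) middle≈0 x y = begin
    pow R (x + y) (suc n)               ≡⟨ pow≡^ (x + y) (suc n) ⟩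
    (x + y) Exp.^ suc n                 ≈⟨ theorem (suc n) x y ⟩
    t Fin.zero + sum (t ∘ Fin.suc)      ≈⟨ +-congˡ (sum-single +-monoid (t ∘ Fin.suc) (Fin.fromℕ n) middle) ⟩
    t Fin.zero + t (Fin.fromℕ (suc n))  ≈⟨ +-cong first last ⟩
    pow R y (suc n) + pow R x (suc n)   ≈⟨ +-comm _ _ ⟩
    pow R x (suc n) + pow R y (suc n)   ∎
    where
    t = binomialTerm x y (suc n)
    first : t Fin.zero ≈ pow R y (suc n)
    first = trans (Mult.×-homo-1 _) (trans (*-identityˡ _) (reflexive (≡.sym (pow≡^ y (suc n)))))
    last : t (Fin.fromℕ (suc n)) ≈ pow R x (suc n)
    last rewrite Fin.toℕ-fromℕ n | nCn≡1 (suc n) | ℕ.n∸n≡0 n =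
      trans (Mult.×-homo-1 _) (trans (*-identityʳ _) (reflexive (≡.sym (pow≡^ x (suc n)))))
    middle : ∀ i → i ≢ Fin.fromℕ n → t (Fin.suc i) ≈ 0#
    middle i i≢n = middle≈0 (suc (toℕ i)) (s≤s z≤n) (s≤s i<n) _
      where
      i<n : toℕ i < n
      i<n = ℕ.≤∧≢⇒< (ℕ.≤-pred (Fin.toℕ<n i)) λ i≡n → i≢n (Fin.toℕ-injective (≡.trans i≡n (≡.sym (Fin.toℕ-fromℕ n))))

CharacteristicDivides : CommutativeRing 0ℓ 0ℓ → ℕ → Set
CharacteristicDivides R n = n Mult.× 1# ≈ 0#
  where
  open CommutativeRing R
  import Algebra.Properties.Semiring.Mult semiring as Mult

module Frobenius (R : CommutativeRing 0ℓ 0ℓ) {p} (p-prime : Prime p) (p×1≈0 : CharacteristicDivides R p) where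
  open CommutativeRing R
  open Powers R
  import Algebra.Properties.Semiring.Mult semiring as Mult
  open import Relation.Binary.Reasoning.Setoid setoid

  p×x≈0 : ∀ x → p Mult.× x ≈ 0#
  p×x≈0 x = begin
    p Mult.× x          ≈⟨ Mult.×-congʳ p (*-identityˡ x) ⟨
    p Mult.× (1# * x)   ≈⟨ Mult.×-assoc-* p 1# x ⟨
    (p Mult.× 1#) * x   ≈⟨ *-congʳ p×1≈0 ⟩
    0# * x              ≈⟨ zeroˡ x ⟩
    0#                  ∎

  p∣n⇒n×x≈0 : ∀ {n} → p ∣ n → ∀ x → n Mult.× x ≈ 0#
  p∣n⇒n×x≈0 (divides t ≡.refl) x = begin
    (t ℕ.* p) Mult.× x     ≡⟨ ≡.cong (Mult._× x) (ℕ.*-comm t p) ⟩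
    (p ℕ.* t) Mult.× x     ≈⟨ Mult.×-assocˡ x p t ⟨
    p Mult.× (t Mult.× x)  ≈⟨ p×x≈0 (t Mult.× x) ⟩
    0#                     ∎

  pow-p-homo-+ : ∀ x y → pow R (x + y) p ≈ pow R x p + pow R y p
  pow-p-homo-+ = binomial-middle≈0⇒pow-homo-+ p {{prime⇒nonZero p-prime}}
    (λ k 0<k k<p → p∣n⇒n×x≈0 (prime∣pCk p-prime 0<k k<p))

  pow-pⁿ-homo-+ : ∀ n x y → pow R (x + y) (p ^ n) ≈ pow R x (p ^ n) + pow R y (p ^ n)
  pow-pⁿ-homo-+ zero    x y = distribʳ 1# x y
  pow-pⁿ-homo-+ (suc n) x y = begin
    pow R (x + y) (p ℕ.* p ^ n)                            ≈⟨ pow-pow (x + y) p (p ^ n) ⟨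
    pow R (pow R (x + y) p) (p ^ n)                        ≈⟨ pow-cong (p ^ n) (pow-p-homo-+ x y) ⟩
    pow R (pow R x p + pow R y p) (p ^ n)                  ≈⟨ pow-pⁿ-homo-+ n (pow R x p) (pow R y p) ⟩
    pow R (pow R x p) (p ^ n) + pow R (pow R y p) (p ^ n)  ≈⟨ +-cong (pow-pow x p (p ^ n)) (pow-pow y p (p ^ n)) ⟩
    pow R x (p ℕ.* p ^ n) + pow R y (p ℕ.* p ^ n)          ∎

NoZeroDivisors : CommutativeRing 0ℓ 0ℓ → Set
NoZeroDivisors R = ∀ {x} → ¬ x ≈ 0# → ∀ {y} → x * y ≈ 0# → y ≈ 0#
  where open CommutativeRing R

module Polynomials (R : CommutativeRing 0ℓ 0ℓ) (no-zero-divisors : NoZeroDivisors R) where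
  open CommutativeRing R
  open Sums R
  open import Algebra.Properties.Ring ring using ([y-z]x≈yx-zx; x≈y⇒x∙y⁻¹≈ε; x∙y⁻¹≈ε⇒x≈y)
  open import Algebra.Solver.Ring.NaturalCoefficients.Default commutativeSemiring
  open import Relation.Binary.Reasoning.Setoid setoid

  horner : ∀ n → (Fin n → Carrier) → Carrier → Carrier
  horner zero    c x = 0#
  horner (suc n) c x = c Fin.zero + x * horner n (c ∘ Fin.suc) x

  horner≈sumFin : ∀ n c x → horner n c x ≈ sumFin R n (λ e → c e * pow R x (toℕ e))
  horner≈sumFin zero    c x = refl
  horner≈sumFin (suc n) c x = +-cong (sym (*-identityʳ _)) (begin
    x * horner n (c ∘ Fin.suc) x                                  ≈⟨ *-congˡ (horner≈sumFin n (c ∘ Fin.suc) x) ⟩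
    x * sumFin R n (λ e → c (Fin.suc e) * pow R x (toℕ e))         ≈⟨ *-distribˡ-sumFin n x _ ⟩
    sumFin R n (λ e → x * (c (Fin.suc e) * pow R x (toℕ e)))       ≈⟨ sumFin-cong n (λ e → x*[c*y]≈c*[x*y] x _ _) ⟩
    sumFin R n (λ e → c (Fin.suc e) * (x * pow R x (toℕ e)))       ∎)
    where
    x*[c*y]≈c*[x*y] : ∀ x c y → x * (c * y) ≈ c * (x * y)
    x*[c*y]≈c*[x*y] = solve 3 (λ x c y → x :* (c :* y) := c :* (x :* y)) refl

  -- Synthetic division by X - a.
  quotient : ∀ n → (Fin (suc n) → Carrier) → Carrier → Fin n → Carrier
  quotient (suc n) c a Fin.zero    = horner (suc n) (c ∘ Fin.suc) a
  quotient (suc n) c a (Fin.suc i) = quotient n (c ∘ Fin.suc) a i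

  -- c(x) - c(a) = (x - a) q(x), with both sides moved so that no subtraction occurs.
  quotient-spec : ∀ n c a x → horner (suc n) c x + a * horner n (quotient n c a) x
                            ≈ horner (suc n) c a + x * horner n (quotient n c a) x
  quotient-spec zero c a x =
    solve 3 (λ c x a → (c :+ x :* con 0) :+ a :* con 0 := (c :+ a :* con 0) :+ x :* con 0) refl (c Fin.zero) x a
  quotient-spec (suc n) c a x = begin
    (c₀ + x * cx) + a * (ca + x * qx)  ≈⟨ solve 6 (λ c₀ x a cx ca qx → (c₀ :+ x :* cx) :+ a :* (ca :+ x :* qx)
                                                              := (c₀ :+ a :* ca) :+ x :* (cx :+ a :* qx)) refl c₀ x a cx ca qx ⟩
    (c₀ + a * ca) + x * (cx + a * qx)  ≈⟨ +-congˡ (*-congˡ (quotient-spec n (c ∘ Fin.suc) a x)) ⟩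
    (c₀ + a * ca) + x * (ca + x * qx)  ∎
    where
    c₀ = c Fin.zero
    cx = horner (suc n) (c ∘ Fin.suc) x
    ca = horner (suc n) (c ∘ Fin.suc) a
    qx = horner n (quotient n (c ∘ Fin.suc) a) x

  quotient≈0⇒≈0 : ∀ n c a → (∀ i → quotient n c a i ≈ 0#) → horner (suc n) c a ≈ 0# → ∀ e → c e ≈ 0#
  quotient≈0⇒≈0 zero    c a q≈0 ca≈0 Fin.zero = trans (sym (trans (+-congˡ (zeroʳ a)) (+-identityʳ _))) ca≈0
  quotient≈0⇒≈0 (suc n) c a q≈0 ca≈0 Fin.zero =
    trans (sym (trans (+-congˡ (trans (*-congˡ (q≈0 Fin.zero)) (zeroʳ a))) (+-identityʳ _))) ca≈0
  quotient≈0⇒≈0 (suc n) c a q≈0 ca≈0 (Fin.suc e) =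
    quotient≈0⇒≈0 n (c ∘ Fin.suc) a (q≈0 ∘ Fin.suc) (q≈0 Fin.zero) e

  roots⇒coefficients≈0 : ∀ n (c root : Fin n → Carrier) → (∀ i j → root i ≈ root j → i ≡ j) →
                         (∀ i → horner n c (root i) ≈ 0#) → ∀ e → c e ≈ 0#
  roots⇒coefficients≈0 zero    c root root-injective c[root]≈0 ()
  roots⇒coefficients≈0 (suc n) c root root-injective c[root]≈0 =
    quotient≈0⇒≈0 n c a (roots⇒coefficients≈0 n (quotient n c a) (root ∘ Fin.suc)
      (λ i j eq → Fin.suc-injective (root-injective _ _ eq)) q[root]≈0) (c[root]≈0 Fin.zero)
    where
    a = root Fin.zero
    q[root]≈0 : ∀ i → horner n (quotient n c a) (root (Fin.suc i)) ≈ 0#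
    q[root]≈0 i = no-zero-divisors (λ x-a≈0 → Fin.0≢1+n (root-injective _ _ (sym (x∙y⁻¹≈ε⇒x≈y x a x-a≈0))))
      (begin
        (x - a) * q             ≈⟨ [y-z]x≈yx-zx q x a ⟩
        x * q - a * q           ≈⟨ x≈y⇒x∙y⁻¹≈ε (begin
          x * q                   ≈⟨ +-identityˡ _ ⟨
          0# + x * q              ≈⟨ +-congʳ (c[root]≈0 Fin.zero) ⟨
          horner (suc n) c a + x * q ≈⟨ quotient-spec n c a x ⟨
          horner (suc n) c x + a * q ≈⟨ +-congʳ (c[root]≈0 (Fin.suc i)) ⟩
          0# + a * q              ≈⟨ +-identityˡ _ ⟩
          a * q                   ∎) ⟩
        0#                      ∎)
      where
      x = root (Fin.suc i)
      q = horner n (quotient n c a) x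

module FiniteFields (R : CommutativeRing 0ℓ 0ℓ) {N} (F : IsFieldOfOrder R N) where
  open CommutativeRing R
  open IsFieldOfOrder F
  open Powers R
  open import Algebra.Properties.Ring ring using (+-identityʳ-unique; //-rightDividesˡ; //-rightDividesʳ)
  import Algebra.Properties.Semiring.Mult semiring as Mult
  import Algebra.Properties.CommutativeMonoid.Sum +-commutativeMonoid as Sum
  import Algebra.Properties.CommutativeMonoid.Sum *-commutativeMonoid as Product
  import Algebra.Properties.CommutativeSemiring.Exp commutativeSemiring as Exp
  open import Relation.Binary.Definitions using (Decidable)
  open import Relation.Nullary.Decidable using (map′)
  open import Relation.Binary.Reasoning.Setoid setoid

  index : Carrier → Fin N
  index x = proj₁ (enum-sur x)

  enum-index : ∀ x → enum (index x) ≈ x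
  enum-index x = proj₂ (enum-sur x)

  index-cong : ∀ {x y} → x ≈ y → index x ≡ index y
  index-cong {x} {y} x≈y = enum-inj _ _ (trans (enum-index x) (trans x≈y (sym (enum-index y))))

  index-injective : ∀ {x y} → index x ≡ index y → x ≈ y
  index-injective {x} {y} eq = trans (sym (enum-index x)) (trans (reflexive (≡.cong enum eq)) (enum-index y))

  infix 4 _≟_
  _≟_ : Decidable _≈_
  x ≟ y = map′ index-injective index-cong (index x Fin.≟ index y)

  induced : (f g : Carrier → Carrier) → (∀ {x y} → x ≈ y → f x ≈ f y) → (∀ {x y} → x ≈ y → g x ≈ g y) →
            (∀ x → f (g x) ≈ x) → (∀ x → g (f x) ≈ x) → Permutation N N
  induced f g f-cong g-cong fg≈id gf≈id = permutation (index ∘ f ∘ enum) (index ∘ g ∘ enum)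
    (λ i → enum-inj _ _ (trans (enum-index _) (trans (f-cong (enum-index _)) (fg≈id _))))
    (λ i → enum-inj _ _ (trans (enum-index _) (trans (g-cong (enum-index _)) (gf≈id _))))

  ifZero : Carrier → Carrier → Carrier → Carrier
  ifZero y a b with y ≟ 0#
  ... | yes _ = a
  ... | no  _ = b

  ifZero-≈0 : ∀ {y} a b → y ≈ 0# → ifZero y a b ≈ a
  ifZero-≈0 {y} a b y≈0 with y ≟ 0#
  ... | yes _   = refl
  ... | no  y≉0 = ⊥-elim (y≉0 y≈0)

  ifZero-≉0 : ∀ {y} a b → ¬ y ≈ 0# → ifZero y a b ≈ b
  ifZero-≉0 {y} a b y≉0 with y ≟ 0#
  ... | yes y≈0 = ⊥-elim (y≉0 y≈0)
  ... | no  _   = refl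

  unit : Carrier → Carrier
  unit y = ifZero y 1# y

  unit-cong : ∀ {y z} → y ≈ z → unit y ≈ unit z
  unit-cong {y} {z} y≈z with y ≟ 0#
  ... | yes y≈0 = sym (ifZero-≈0 1# z (trans (sym y≈z) y≈0))
  ... | no  y≉0 = trans y≈z (sym (ifZero-≉0 1# z (y≉0 ∘ trans y≈z)))

  unit≉0 : ∀ y → ¬ unit y ≈ 0#
  unit≉0 y with y ≟ 0#
  ... | yes _   = 0≉1 ∘ sym
  ... | no  y≉0 = y≉0

  module _ {x} (x≉0 : ¬ x ≈ 0#) where
    private
      x⁻¹ = proj₁ (inverse x x≉0)
      x*x⁻¹≈1 : x * x⁻¹ ≈ 1#
      x*x⁻¹≈1 = proj₂ (inverse x x≉0)
      x⁻¹*x≈1 : x⁻¹ * x ≈ 1#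
      x⁻¹*x≈1 = trans (*-comm _ _) x*x⁻¹≈1

    x⁻¹*[x*y]≈y : ∀ y → x⁻¹ * (x * y) ≈ y
    x⁻¹*[x*y]≈y y = trans (sym (*-assoc _ _ _)) (trans (*-congʳ x⁻¹*x≈1) (*-identityˡ y))

    x*[x⁻¹*y]≈y : ∀ y → x * (x⁻¹ * y) ≈ y
    x*[x⁻¹*y]≈y y = trans (sym (*-assoc _ _ _)) (trans (*-congʳ x*x⁻¹≈1) (*-identityˡ y))

    *-cancelˡ : ∀ {y z} → x * y ≈ x * z → y ≈ z
    *-cancelˡ {y} {z} xy≈xz = trans (sym (x⁻¹*[x*y]≈y y)) (trans (*-congˡ xy≈xz) (x⁻¹*[x*y]≈y z))

    *-cancelʳ : ∀ {y z} → y * x ≈ z * x → y ≈ z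
    *-cancelʳ yx≈zx = *-cancelˡ (trans (*-comm _ _) (trans yx≈zx (*-comm _ _)))

    no-zero-divisors : ∀ {y} → x * y ≈ 0# → y ≈ 0#
    no-zero-divisors xy≈0 = *-cancelˡ (trans xy≈0 (sym (zeroʳ _)))

    scaling : Permutation N N
    scaling = induced (x *_) (x⁻¹ *_) *-congˡ *-congˡ x*[x⁻¹*y]≈y x⁻¹*[x*y]≈y

  translation : Permutation N N
  translation = induced (_+ 1#) (_- 1#) +-congʳ +-congʳ (//-rightDividesˡ 1#) (//-rightDividesʳ 1#)

  N×1≈0 : N Mult.× 1# ≈ 0#
  N×1≈0 = +-identityʳ-unique S (N Mult.× 1#) (sym (begin
    S                                         ≈⟨ Sum.∑-permute enum translation ⟩
    Sum.sum (λ i → enum (translation ⟨$⟩ʳ i))  ≈⟨ Sum.sum-cong-≋ {N} (λ i → enum-index _) ⟩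
    Sum.sum (λ i → enum i + 1#)               ≈⟨ Sum.∑-distrib-+ enum (λ _ → 1#) ⟩
    S + Sum.sum {N} (λ _ → 1#)                ≈⟨ +-congˡ (Sum.sum-replicate N) ⟩
    S + N Mult.× 1#                           ∎))
    where
    S = Sum.sum enum

  pow≈0⇒≈0 : ∀ n {y} → pow R y n ≈ 0# → y ≈ 0#
  pow≈0⇒≈0 zero    1≈0 = ⊥-elim (0≉1 (sym 1≈0))
  pow≈0⇒≈0 (suc n) {y} yⁿ⁺¹≈0 with y ≟ 0#
  ... | yes y≈0 = y≈0
  ... | no  y≉0 = pow≈0⇒≈0 n (no-zero-divisors y≉0 yⁿ⁺¹≈0)

  order≡pᵉ⇒p×1≈0 : ∀ p e → N ≡ p ^ e → CharacteristicDivides R p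
  order≡pᵉ⇒p×1≈0 p e N≡pᵉ = pow≈0⇒≈0 e (begin
    pow R (p Mult.× 1#) e   ≈⟨ pᵉ×1≈[p×1]ᵉ e ⟨
    (p ^ e) Mult.× 1#       ≡⟨ ≡.cong (Mult._× 1#) N≡pᵉ ⟨
    N Mult.× 1#             ≈⟨ N×1≈0 ⟩
    0#                      ∎)
    where
    pᵉ×1≈[p×1]ᵉ : ∀ e → (p ^ e) Mult.× 1# ≈ pow R (p Mult.× 1#) e
    pᵉ×1≈[p×1]ᵉ zero    = +-identityʳ 1#
    pᵉ×1≈[p×1]ᵉ (suc e) = trans (Mult.×1-homo-* p (p ^ e)) (*-congˡ (pᵉ×1≈[p×1]ᵉ e))

  product≉0 : ∀ n (f : Fin n → Carrier) → (∀ i → ¬ f i ≈ 0#) → ¬ Product.sum f ≈ 0#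
  product≉0 zero    f f≉0 1≈0 = 0≉1 (sym 1≈0)
  product≉0 (suc n) f f≉0 = product≉0 n (f ∘ Fin.suc) (f≉0 ∘ Fin.suc) ∘ no-zero-divisors (f≉0 Fin.zero)

  module _ {x} (x≉0 : ¬ x ≈ 0#) where
    factor : Carrier → Carrier
    factor y = ifZero y x 1#

    x*unit≈factor*unit[x*] : ∀ y → x * unit y ≈ factor y * unit (x * y)
    x*unit≈factor*unit[x*] y with y ≟ 0#
    ... | yes y≈0 = *-congˡ (sym (ifZero-≈0 1# _ (trans (*-congˡ y≈0) (zeroʳ x))))
    ... | no  y≉0 = trans (sym (ifZero-≉0 1# _ (y≉0 ∘ no-zero-divisors x≉0))) (sym (*-identityˡ _))

    product-factor≈x : Product.sum (factor ∘ enum) ≈ x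
    product-factor≈x = trans (sum-single *-monoid _ (index 0#) factor≈1) (ifZero-≈0 x 1# (enum-index 0#))
      where
      factor≈1 : ∀ i → i ≢ index 0# → factor (enum i) ≈ 1#
      factor≈1 i i≢0 = ifZero-≉0 x 1# (i≢0 ∘ enum-inj _ _ ∘ λ eᵢ≈0 → trans eᵢ≈0 (sym (enum-index 0#)))

    -- Scaling by x permutes the field, so ∏ᵢ unit (x eᵢ) = ∏ᵢ unit eᵢ = P, while ∏ᵢ x · unit eᵢ = xᴺ P;
    -- the two products differ only in the factor at eᵢ = 0, which is x on the left.
    x^N≈x-nonzero : pow R x N ≈ x
    x^N≈x-nonzero = *-cancelʳ (product≉0 N (unit ∘ enum) (unit≉0 ∘ enum)) (begin
      pow R x N * P
        ≡⟨ ≡.cong (_* P) (pow≡^ x N) ⟩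
      x Exp.^ N * P
        ≈⟨ *-congʳ (Product.sum-replicate N) ⟨
      Product.sum {N} (λ _ → x) * P
        ≈⟨ Product.∑-distrib-+ (λ _ → x) (unit ∘ enum) ⟨
      Product.sum (λ i → x * unit (enum i))
        ≈⟨ Product.sum-cong-≋ {N} (x*unit≈factor*unit[x*] ∘ enum) ⟩
      Product.sum (λ i → factor (enum i) * unit (x * enum i))
        ≈⟨ Product.∑-distrib-+ (factor ∘ enum) (λ i → unit (x * enum i)) ⟩
      Product.sum (factor ∘ enum) * Product.sum (λ i → unit (x * enum i))
        ≈⟨ *-cong product-factor≈x P[x*]≈P ⟩
      x * P
        ∎)
      where
      P = Product.sum (unit ∘ enum)
      P[x*]≈P : Product.sum (λ i → unit (x * enum i)) ≈ P
      P[x*]≈P = trans (Product.sum-cong-≋ {N} (λ i → unit-cong (sym (enum-index _))))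
                      (sym (Product.∑-permute (unit ∘ enum) (scaling x≉0)))

  x^N≈x : ∀ x → pow R x N ≈ x
  x^N≈x x with x ≟ 0#
  ... | no  x≉0 = x^N≈x-nonzero x≉0
  ... | yes x≈0 = trans (pow-cong N x≈0) (trans (0ⁿ≈0 (index 0#)) (sym x≈0))
    where
    0ⁿ≈0 : ∀ {n} → Fin n → pow R 0# n ≈ 0#
    0ⁿ≈0 {suc n} _ = zeroˡ _

module Matrices (R : CommutativeRing 0ℓ 0ℓ) (n : ℕ) where
  open CommutativeRing R
  open Sums R
  open import Relation.Binary.Reasoning.Setoid setoid

  apply-cong : ∀ {A B u v} → _≈M_ R A B → _≈V_ R u v → _≈V_ R (apply R n A u) (apply R n B v)
  apply-cong A≈B u≈v i = sumFin-cong n (λ j → *-cong (A≈B i j) (u≈v j))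

  apply-congʳ : ∀ A {u v} → _≈V_ R u v → _≈V_ R (apply R n A u) (apply R n A v)
  apply-congʳ A = apply-cong {A} (λ _ _ → refl)

  apply-mmul : ∀ A B u → _≈V_ R (apply R n (mmul R n A B) u) (apply R n A (apply R n B u))
  apply-mmul A B u i = begin
    sumFin R n (λ k → sumFin R n (λ j → A i j * B j k) * u k)
      ≈⟨ sumFin-cong n (λ k → *-distribʳ-sumFin n (u k) _) ⟩
    sumFin R n (λ k → sumFin R n (λ j → (A i j * B j k) * u k))
      ≈⟨ sumFin-comm n n _ ⟩
    sumFin R n (λ j → sumFin R n (λ k → (A i j * B j k) * u k))
      ≈⟨ sumFin-cong n (λ j → sumFin-cong n (λ k → *-assoc _ _ _)) ⟩
    sumFin R n (λ j → sumFin R n (λ k → A i j * (B j k * u k)))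
      ≈⟨ sumFin-cong n (λ j → *-distribˡ-sumFin n (A i j) _) ⟨
    sumFin R n (λ j → A i j * sumFin R n (λ k → B j k * u k))
      ∎

  apply-identity : ∀ u → _≈V_ R (apply R n (identity R n) u) u
  apply-identity u i = trans (sumFin-single n _ i off-diagonal) diagonal
    where
    off-diagonal : ∀ j → j ≢ i → identity R n i j * u j ≈ 0#
    off-diagonal j j≢i with i Fin.≟ j
    ... | yes i≡j = ⊥-elim (j≢i (≡.sym i≡j))
    ... | no  _   = zeroˡ (u j)
    diagonal : identity R n i i * u i ≈ u i
    diagonal with i Fin.≟ i
    ... | yes _   = *-identityˡ (u i)
    ... | no  i≢i = ⊥-elim (i≢i ≡.refl)

module LinearizedPolynomials (R : CommutativeRing 0ℓ 0ℓ) (q m s : ℕ) .{{_ : NonZero m}}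
                             {p k} (p-prime : Prime p) (k≥1 : 1 ≤ k) (q≡pᵏ : q ≡ p ^ k) (gcd≡1 : gcd s m ≡ 1)
                             (F : IsFieldOfOrder R (q ^ m)) where
  open CommutativeRing R
  open IsFieldOfOrder F using (enum; enum-inj)
  open Sums R
  open Powers R
  open FiniteFields R F
  open Polynomials R no-zero-divisors
  open Matrices R m
  open import Algebra.Properties.Ring ring using ([y-z]x≈yx-zx; x≈y⇒x∙y⁻¹≈ε; x∙y⁻¹≈ε⇒x≈y; -‿+-comm)
  open import Relation.Binary.Reasoning.Setoid setoid

  N : ℕ
  N = q ^ m

  qᵃ≡pᵏᵃ : ∀ a → q ^ a ≡ p ^ (k ℕ.* a)
  qᵃ≡pᵏᵃ a = ≡.trans (≡.cong (_^ a) q≡pᵏ) (ℕ.^-*-assoc p k a)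

  open Frobenius R p-prime (order≡pᵉ⇒p×1≈0 p (k ℕ.* m) (qᵃ≡pᵏᵃ m))

  frob : ℕ → Carrier → Carrier
  frob a x = pow R x (q ^ a)

  frob-cong : ∀ a {x y} → x ≈ y → frob a x ≈ frob a y
  frob-cong a = pow-cong (q ^ a)

  frob-+ : ∀ a x y → frob a (x + y) ≈ frob a x + frob a y
  frob-+ a x y rewrite qᵃ≡pᵏᵃ a = pow-pⁿ-homo-+ (k ℕ.* a) x y

  frob-* : ∀ a x y → frob a (x * y) ≈ frob a x * frob a y
  frob-* a x y = pow-distrib-* x y (q ^ a)

  frob-sumFin : ∀ a n (f : Fin n → Carrier) → frob a (sumFin R n f) ≈ sumFin R n (frob a ∘ f)
  frob-sumFin a = sumFin-homo (frob a) (frob-cong a) (frob-+ a)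

  frob-frob : ∀ a b x → frob a (frob b x) ≈ frob (b ℕ.+ a) x
  frob-frob a b x = trans (pow-pow x (q ^ b) (q ^ a)) (reflexive (≡.cong (pow R x) (≡.sym (ℕ.^-distribˡ-+-* q b a))))

  frob-*m : ∀ t x → frob (t ℕ.* m) x ≈ x
  frob-*m zero    x = *-identityʳ x
  frob-*m (suc t) x = trans (sym (frob-frob (t ℕ.* m) m x)) (trans (frob-cong (t ℕ.* m) (x^N≈x x)) (frob-*m t x))

  frob-% : ∀ a x → frob a x ≈ frob (a % m) x
  frob-% a x = begin
    frob a x                           ≡⟨ ≡.cong (λ b → frob b x) (m≡m%n+[m/n]*n a m) ⟩
    frob (a % m ℕ.+ (a / m) ℕ.* m) x   ≈⟨ frob-frob ((a / m) ℕ.* m) (a % m) x ⟨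
    frob ((a / m) ℕ.* m) (frob (a % m) x) ≈⟨ frob-*m (a / m) _ ⟩
    frob (a % m) x                     ∎

  frob-%-cong : ∀ {a b} x → a % m ≡ b % m → frob a x ≈ frob b x
  frob-%-cong {a} {b} x eq = trans (frob-% a x) (trans (reflexive (≡.cong (λ c → frob c x) eq)) (sym (frob-% b x)))

  Vec : Set
  Vec = Vector R m

  Mat : Set
  Mat = Matrix R m

  conjugates : Carrier → Vec
  conjugates x j = frob (s ℕ.* toℕ j) x

  ⟦_⟧ : Vec → Carrier → Carrier
  ⟦_⟧ = evalQPoly R q m s

  i₀ : Fin m
  i₀ = fromℕ< (ℕ.>-nonZero⁻¹ m)

  conjugates-i₀ : ∀ x → conjugates x i₀ ≈ x
  conjugates-i₀ x = trans (reflexive (≡.cong (λ j → frob (s ℕ.* j) x) (Fin.toℕ-fromℕ< _)))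
                          (trans (reflexive (≡.cong (λ a → frob a x) (ℕ.*-zeroʳ s))) (*-identityʳ x))

  conjugates-cong : ∀ {x y} → x ≈ y → _≈V_ R (conjugates x) (conjugates y)
  conjugates-cong x≈y j = frob-cong (s ℕ.* toℕ j) x≈y

  ⟦⟧-cong : ∀ a {x y} → x ≈ y → ⟦ a ⟧ x ≈ ⟦ a ⟧ y
  ⟦⟧-cong a x≈y = sumFin-cong m (λ j → *-congˡ (conjugates-cong x≈y j))

  ⟦⟧-congˡ : ∀ {a b} → _≈V_ R a b → ∀ x → ⟦ a ⟧ x ≈ ⟦ b ⟧ x
  ⟦⟧-congˡ a≈b x = sumFin-cong m (λ j → *-congʳ (a≈b j))

  Induces : Mat → (Carrier → Carrier) → Set
  Induces A g = ∀ x → _≈V_ R (apply R m A (conjugates x)) (conjugates (g x))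

  dickson-induces : ∀ a → Induces (dickson R q m s a) ⟦ a ⟧
  dickson-induces a x i = begin
    sumFin R m (λ j → D i j * conjugates x j)                               ≈⟨ sumFin-permute m _ (rotate i) ⟩
    sumFin R m (λ k → D i (rotate i ⟨$⟩ʳ k) * conjugates x (rotate i ⟨$⟩ʳ k)) ≈⟨ sumFin-cong m rotated-term ⟩
    sumFin R m (λ k → frob si (a k) * frob si (conjugates x k))             ≈⟨ sumFin-cong m (λ k → frob-* si _ _) ⟨
    sumFin R m (λ k → frob si (a k * conjugates x k))                       ≈⟨ frob-sumFin si m _ ⟨
    frob si (⟦ a ⟧ x)                                                       ∎
    where
    D = dickson R q m s a
    si = s ℕ.* toℕ i
    rotated-term : ∀ k → D i (rotate i ⟨$⟩ʳ k) * conjugates x (rotate i ⟨$⟩ʳ k)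
                       ≈ frob si (a k) * frob si (conjugates x k)
    rotated-term k = *-cong (reflexive (≡.cong (frob si ∘ a) (Perm.inverseˡ (rotate i))))
      (trans (frob-%-cong x (*-rotate-% s i k)) (sym (frob-frob si (s ℕ.* toℕ k) x)))

  1<q : 1 < q
  1<q = ≡.subst₂ _<_ (ℕ.^-zeroˡ k) (≡.sym q≡pᵏ)
          (ℕ.^-monoˡ-< k {{ℕ.>-nonZero k≥1}} (ℕ.nonTrivial⇒n>1 p {{prime⇒nonTrivial p-prime}}))

  q^[sj%m]<N : ∀ (j : Fin m) → q ^ ((s ℕ.* toℕ j) % m) < N
  q^[sj%m]<N j = ℕ.^-monoʳ-< q 1<q (m%n<n (s ℕ.* toℕ j) m)

  degree : Fin m → Fin N
  degree j = fromℕ< (q^[sj%m]<N j)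

  degree-injective : ∀ {i j} → degree i ≡ degree j → i ≡ j
  degree-injective {i} {j} eq = Fin.toℕ-injective (coprime⇒*-%-injective m s gcd≡1 (Fin.toℕ<n i) (Fin.toℕ<n j)
                                  (^-injectiveʳ 1<q (Fin.fromℕ<-injective _ _ _ _ eq)))

  conjugates≈pow-degree : ∀ x j → conjugates x j ≈ pow R x (toℕ (degree j))
  conjugates≈pow-degree x j =
    trans (frob-% (s ℕ.* toℕ j) x) (reflexive (≡.cong (pow R x) (≡.sym (Fin.toℕ-fromℕ< (q^[sj%m]<N j)))))

  when : ∀ {P : Set} → Dec P → Carrier → Carrier
  when (yes _) v = v
  when (no  _) _ = 0#

  when-yes : ∀ {P : Set} (d : Dec P) {v} → P → when d v ≈ v
  when-yes (yes _) _  = refl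
  when-yes (no ¬p) pf = ⊥-elim (¬p pf)

  when-no : ∀ {P : Set} (d : Dec P) {v} → ¬ P → when d v ≈ 0#
  when-no (yes pf) ¬p = ⊥-elim (¬p pf)
  when-no (no _)   _  = refl

  -- Σⱼ cⱼ x^(degree j) is a polynomial of degree < N vanishing on all N field elements, and its
  -- coefficients are the cⱼ because degree is injective.
  conjugates-independent : ∀ (c : Vec) → (∀ x → sumFin R m (λ j → c j * conjugates x j) ≈ 0#) → ∀ j → c j ≈ 0#
  conjugates-independent c Σc·conj≈0 j = begin
    c j                     ≈⟨ coefficient-degree ⟨
    coefficient (degree j)  ≈⟨ roots⇒coefficients≈0 N coefficient enum enum-inj
                                 (λ i → trans (horner-coefficient (enum i)) (Σc·conj≈0 (enum i))) (degree j) ⟩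
    0#                      ∎
    where
    coefficient : Fin N → Carrier
    coefficient e = sumFin R m (λ j → when (degree j Fin.≟ e) (c j))

    coefficient-degree : coefficient (degree j) ≈ c j
    coefficient-degree =
      trans (sumFin-single m _ j λ j′ j′≢j → when-no (degree j′ Fin.≟ degree j) (j′≢j ∘ degree-injective))
            (when-yes (degree j Fin.≟ degree j) ≡.refl)

    monomial : ∀ x j → sumFin R N (λ e → when (degree j Fin.≟ e) (c j) * pow R x (toℕ e)) ≈ c j * conjugates x j
    monomial x j =
      trans (sumFin-single N _ (degree j) λ e e≢ → trans (*-congʳ (when-no (degree j Fin.≟ e) (e≢ ∘ ≡.sym))) (zeroˡ _))
            (*-cong (when-yes (degree j Fin.≟ degree j) ≡.refl) (sym (conjugates≈pow-degree x j)))

    horner-coefficient : ∀ x → horner N coefficient x ≈ sumFin R m (λ j → c j * conjugates x j)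
    horner-coefficient x = begin
      horner N coefficient x
        ≈⟨ horner≈sumFin N coefficient x ⟩
      sumFin R N (λ e → coefficient e * pow R x (toℕ e))
        ≈⟨ sumFin-cong N (λ e → *-distribʳ-sumFin m _ _) ⟩
      sumFin R N (λ e → sumFin R m (λ j → when (degree j Fin.≟ e) (c j) * pow R x (toℕ e)))
        ≈⟨ sumFin-comm N m _ ⟩
      sumFin R m (λ j → sumFin R N (λ e → when (degree j Fin.≟ e) (c j) * pow R x (toℕ e)))
        ≈⟨ sumFin-cong m (monomial x) ⟩
      sumFin R m (λ j → c j * conjugates x j)
        ∎

  induces-unique : ∀ {A B g h} → Induces A g → Induces B h → (∀ x → g x ≈ h x) → _≈M_ R A B
  induces-unique {A} {B} {g} {h} A↝g B↝h g≈h i j =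
    x∙y⁻¹≈ε⇒x≈y _ _ (conjugates-independent (λ j → A i j - B i j) Σ≈0 j)
    where
    Σ≈0 : ∀ x → sumFin R m (λ j → (A i j - B i j) * conjugates x j) ≈ 0#
    Σ≈0 x = begin
      sumFin R m (λ j → (A i j - B i j) * conjugates x j)                   ≈⟨ sumFin-cong m (λ j → [y-z]x≈yx-zx _ _ _) ⟩
      sumFin R m (λ j → A i j * conjugates x j - B i j * conjugates x j)    ≈⟨ sumFin-distrib-+ m _ _ ⟩
      apply R m A (conjugates x) i + sumFin R m (λ j → - (B i j * conjugates x j))
        ≈⟨ +-congˡ (sumFin-homo -_ -‿cong (λ y z → sym (-‿+-comm y z)) m _) ⟨
      apply R m A (conjugates x) i - apply R m B (conjugates x) i           ≈⟨ x≈y⇒x∙y⁻¹≈ε Ax≈Bx ⟩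
      0#                                                                    ∎
      where
      Ax≈Bx : apply R m A (conjugates x) i ≈ apply R m B (conjugates x) i
      Ax≈Bx = trans (A↝g x i) (trans (conjugates-cong (g≈h x) i) (sym (B↝h x i)))

  ≈M-induces : ∀ {A B g} → _≈M_ R A B → Induces B g → Induces A g
  ≈M-induces A≈B B↝g x i = trans (apply-cong A≈B (λ _ → refl) i) (B↝g x i)

  induces-mmul : ∀ {A B g h} → Induces A g → Induces B h → Induces (mmul R m A B) (g ∘ h)
  induces-mmul {A} A↝g B↝h x i =
    trans (apply-mmul A _ _ i) (trans (apply-congʳ A (B↝h x) i) (A↝g _ i))

  identity-induces : Induces (identity R m) (λ x → x)
  identity-induces x = apply-identity (conjugates x)

  induces⇒⟦row⟧ : ∀ {A g} → Induces A g → ∀ x → ⟦ A i₀ ⟧ x ≈ g x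
  induces⇒⟦row⟧ A↝g x = trans (A↝g x i₀) (conjugates-i₀ _)

  maps-into⇒induces : ∀ {A} → (∀ u → InG R q m s u → InG R q m s (apply R m A u)) → Induces A ⟦ A i₀ ⟧
  maps-into⇒induces {A} maps-into x with maps-into (conjugates x) (x , λ _ → refl)
  ... | y , Ax≈y = λ j → trans (Ax≈y j) (conjugates-cong (trans (sym (conjugates-i₀ y)) (sym (Ax≈y i₀))) j)

  left-invertible⇒injective : ∀ {A B g} → _≈M_ R (mmul R m B A) (identity R m) → Induces A g →
                              ∀ x y → g x ≈ g y → x ≈ y
  left-invertible⇒injective {A} {B} {g} BA≈I A↝g x y gx≈gy =
    trans (B-recovers x) (trans (G-cong gx≈gy) (sym (B-recovers y)))
    where
    G : Carrier → Carrier
    G z = apply R m B (conjugates z) i₀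
    G-cong : ∀ {z w} → z ≈ w → G z ≈ G w
    G-cong z≈w = apply-congʳ B (conjugates-cong z≈w) i₀
    B-recovers : ∀ x → x ≈ G (g x)
    B-recovers x = sym (begin
      G (g x)                                      ≈⟨ apply-congʳ B (A↝g x) i₀ ⟨
      apply R m B (apply R m A (conjugates x)) i₀  ≈⟨ apply-mmul B A _ i₀ ⟨
      apply R m (mmul R m B A) (conjugates x) i₀   ≈⟨ ≈M-induces BA≈I identity-induces x i₀ ⟩
      conjugates x i₀                              ≈⟨ conjugates-i₀ x ⟩
      x                                            ∎)

  compose : Vec → Vec → Vec
  compose c d = mmul R m (dickson R q m s c) (dickson R q m s d) i₀

  ⟦compose⟧ : ∀ c d x → ⟦ compose c d ⟧ x ≈ ⟦ c ⟧ (⟦ d ⟧ x)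
  ⟦compose⟧ c d = induces⇒⟦row⟧ (induces-mmul (dickson-induces c) (dickson-induces d))

  power : Vec → ℕ → Vec
  power a zero    = identity R m i₀
  power a (suc r) = compose a (power a r)

  ⟦power⟧-+ : ∀ a r t x → ⟦ power a (r ℕ.+ t) ⟧ x ≈ ⟦ power a r ⟧ (⟦ power a t ⟧ x)
  ⟦power⟧-+ a zero    t x = sym (induces⇒⟦row⟧ identity-induces _)
  ⟦power⟧-+ a (suc r) t x = begin
    ⟦ power a (suc r ℕ.+ t) ⟧ x                  ≈⟨ ⟦compose⟧ a (power a (r ℕ.+ t)) x ⟩
    ⟦ a ⟧ (⟦ power a (r ℕ.+ t) ⟧ x)              ≈⟨ ⟦⟧-cong a (⟦power⟧-+ a r t x) ⟩
    ⟦ a ⟧ (⟦ power a r ⟧ (⟦ power a t ⟧ x))      ≈⟨ ⟦compose⟧ a (power a r) _ ⟨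
    ⟦ power a (suc r) ⟧ (⟦ power a t ⟧ x)        ∎

  power-injective : ∀ a → (∀ x y → ⟦ a ⟧ x ≈ ⟦ a ⟧ y → x ≈ y) →
                    ∀ r {x y} → ⟦ power a r ⟧ x ≈ ⟦ power a r ⟧ y → x ≈ y
  power-injective a a-injective zero    {x} {y} eq =
    trans (sym (induces⇒⟦row⟧ identity-induces x)) (trans eq (induces⇒⟦row⟧ identity-induces y))
  power-injective a a-injective (suc r) {x} {y} eq = power-injective a a-injective r
    (a-injective _ _ (trans (sym (⟦compose⟧ a (power a r) x)) (trans eq (⟦compose⟧ a (power a r) y))))

  code : Vec → Fin (N ^ m)
  code v = Fin.funToFin (index ∘ v)

  code-injective : ∀ {v w} → code v ≡ code w → _≈V_ R v w
  code-injective {v} {w} eq j = index-injective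
    (≡.trans (≡.sym (Fin.finToFun-funToFin (index ∘ v) j))
    (≡.trans (≡.cong (λ c → Fin.finToFun c j) eq) (Fin.finToFun-funToFin (index ∘ w) j)))

  -- There are only N ^ m coefficient vectors, so two of the powers aⁱ, aʲ (i < j) coincide;
  -- cancelling aⁱ shows that a^(j-i) is the identity, hence a^(j-i-1) inverts a.
  injective⇒invertible : ∀ a → (∀ x y → ⟦ a ⟧ x ≈ ⟦ a ⟧ y → x ≈ y) →
                         Σ Vec λ b → (∀ x → ⟦ a ⟧ (⟦ b ⟧ x) ≈ x) × (∀ x → ⟦ b ⟧ (⟦ a ⟧ x) ≈ x)
  injective⇒invertible a a-injective with Fin.pigeonhole (ℕ.n<1+n (N ^ m)) (λ r → code (power a (toℕ r)))
  ... | i , j , i<j , codeᵢ≡codeⱼ with ℕ.m≤n⇒∃[o]m+o≡n i<j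
  ... | d , 1+i+d≡j = power a d , right-inverse , λ x → a-injective _ _ (right-inverse (⟦ a ⟧ x))
    where
    j≡i+1+d : toℕ j ≡ toℕ i ℕ.+ suc d
    j≡i+1+d = ≡.trans (≡.sym 1+i+d≡j) (≡.sym (ℕ.+-suc (toℕ i) d))
    right-inverse : ∀ x → ⟦ a ⟧ (⟦ power a d ⟧ x) ≈ x
    right-inverse x = sym (power-injective a a-injective (toℕ i) (begin
      ⟦ power a (toℕ i) ⟧ x                          ≈⟨ ⟦⟧-congˡ (code-injective codeᵢ≡codeⱼ) x ⟩
      ⟦ power a (toℕ j) ⟧ x                          ≡⟨ ≡.cong (λ r → ⟦ power a r ⟧ x) j≡i+1+d ⟩
      ⟦ power a (toℕ i ℕ.+ suc d) ⟧ x                ≈⟨ ⟦power⟧-+ a (toℕ i) (suc d) x ⟩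
      ⟦ power a (toℕ i) ⟧ (⟦ power a (suc d) ⟧ x)    ≈⟨ ⟦⟧-cong (power a (toℕ i)) (⟦compose⟧ a (power a d) x) ⟩
      ⟦ power a (toℕ i) ⟧ (⟦ a ⟧ (⟦ power a d ⟧ x))  ∎))

  DicksonForm : Mat → Set
  DicksonForm A = Σ Vec λ a → InvertibleQPoly R q m s a × _≈M_ R A (dickson R q m s a)

  stab⇒dickson : ∀ A → InStab R q m s A → DicksonForm A
  stab⇒dickson A ((B , _ , BA≈I) , maps-into , maps-onto) =
    a , (left-invertible⇒injective BA≈I A↝⟦a⟧ , surjective) , induces-unique A↝⟦a⟧ (dickson-induces a) (λ _ → refl)
    where
    a = A i₀
    A↝⟦a⟧ : Induces A ⟦ a ⟧
    A↝⟦a⟧ = maps-into⇒induces maps-into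
    surjective : ∀ y → Σ Carrier λ x → ⟦ a ⟧ x ≈ y
    surjective y with maps-onto (conjugates y) (y , λ _ → refl)
    ... | u , (x , u≈conj) , Au≈conj = x , (begin
      ⟦ a ⟧ x                         ≡⟨⟩
      apply R m A (conjugates x) i₀   ≈⟨ apply-congʳ A u≈conj i₀ ⟨
      apply R m A u i₀                ≈⟨ Au≈conj i₀ ⟩
      conjugates y i₀                 ≈⟨ conjugates-i₀ y ⟩
      y                               ∎)

  dickson⇒stab : ∀ A → DicksonForm A → InStab R q m s A
  dickson⇒stab A (a , (a-injective , a-surjective) , A≈Dₐ) with injective⇒invertible a a-injective
  ... | b , ⟦a⟧∘⟦b⟧≈id , ⟦b⟧∘⟦a⟧≈id = (dickson R q m s b , A·Dᵦ≈I , Dᵦ·A≈I) , maps-into , maps-onto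
    where
    A↝⟦a⟧ : Induces A ⟦ a ⟧
    A↝⟦a⟧ = ≈M-induces A≈Dₐ (dickson-induces a)
    A·Dᵦ≈I : _≈M_ R (mmul R m A (dickson R q m s b)) (identity R m)
    A·Dᵦ≈I = induces-unique (induces-mmul A↝⟦a⟧ (dickson-induces b)) identity-induces ⟦a⟧∘⟦b⟧≈id
    Dᵦ·A≈I : _≈M_ R (mmul R m (dickson R q m s b) A) (identity R m)
    Dᵦ·A≈I = induces-unique (induces-mmul (dickson-induces b) A↝⟦a⟧) identity-induces ⟦b⟧∘⟦a⟧≈id
    maps-into : ∀ u → InG R q m s u → InG R q m s (apply R m A u)
    maps-into u (x , u≈conj) = ⟦ a ⟧ x , λ j → trans (apply-congʳ A u≈conj j) (A↝⟦a⟧ x j)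
    maps-onto : ∀ v → InG R q m s v → Σ Vec λ u → InG R q m s u × _≈V_ R (apply R m A u) v
    maps-onto v (y , v≈conj) with a-surjective y
    ... | x , ⟦a⟧x≈y = conjugates x , (x , λ _ → refl) ,
                       λ j → trans (A↝⟦a⟧ x j) (trans (conjugates-cong ⟦a⟧x≈y j) (sym (v≈conj j)))

theorem4p4 : (q m s : ℕ) .{{_ : NonZero m}} → IsPrimePower q → 1 ≤ s → s ≤ m → gcd s m ≡ 1
    → (R : CommutativeRing 0ℓ 0ℓ) → IsFieldOfOrder R (q ^ m)
    → (A : Matrix R m)
    → (InStab R q m s A → Σ (Vector R m) λ a → InvertibleQPoly R q m s a × _≈M_ R A (dickson R q m s a))
    × (Σ (Vector R m) (λ a → InvertibleQPoly R q m s a × _≈M_ R A (dickson R q m s a)) → InStab R q m s A)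
theorem4p4 q m s (p , k , p-prime , k≥1 , q≡pᵏ) _ _ gcd≡1 R F A = stab⇒dickson A , dickson⇒stab A
  where open LinearizedPolynomials R q m s p-prime k≥1 q≡pᵏ gcd≡1 F
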